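{- Let $S$ be a modal Kleene algebra and let $a\in S$ be d-confluent, i.e. $\langle a^*|\,|a^*\rangle\le|a^*\rangle\,\langle a^*|$. Then $\mathrm{nrm}\,a$ is d-deterministic, i.e. $\langle\mathrm{nrm}\,a|\,|\mathrm{nrm}\,a\rangle\le\mathbf 1$ (equivalently, $\langle\mathrm{nrm}\,a|(|\mathrm{nrm}\,a\rangle p)\le p$ for every test $p$).
   Context: An idempotent semiring is a structure $(S,+,\cdot,0,1)$ such that $(S,+,0)$ is a commutative monoid with $a+a=a$, $(S,\cdot,1)$ is a monoid, multiplication distributes over addition from both sides, and $0a=a0=0$; natural order $a\le b\iff a+b=b$. A test is an element $p\le 1$ for which some $q$ satisfies $p+q=1$ and $pq=0=qp$; $q$ is unique, written $\neg p$; tests form a Boolean algebra $\mathrm{test}(S)$. $S$ is a modal semiring if for each $a\in S$ there are maps $|a\rangle$ (forward diamond) and $\langle a|$ (backward diamond) on $\mathrm{test}(S)$ with, for all $a,b,p,q$: $|a\rangle p\le q\iff \neg q\,a\,p\le 0$; $\langle a|p\le q\iff p\,a\,\neg q\le 0$; $|ab\rangle p=|a\rangle(|b\rangle p)$; $\langle ab|p=\langle b|(\langle a|p)$. Domain: $\mathrm{dom}\,a=|a\rangle1$. Maps on tests are ordered pointwise, juxtaposition is composition, $\mathbf 1$ is the identity map. A Kleene algebra is an idempotent semiring with ${}^*$ such that $1+aa^*\le a^*$, $b+ac\le c\Rightarrow a^*b\le c$, $1+a^*a\le a^*$, $b+ca\le c\Rightarrow ba^*\le c$; a modal Kleene algebra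 is a Kleene algebra that is a modal semiring. The normaliser of $a$ is $\mathrm{nrm}\,a=a^*\,\neg\mathrm{dom}\,a$. -}

module Defs where

open import Level using (Level; suc; _⊔_)
open import Relation.Binary.PropositionalEquality using (_≡_)
open import Data.Product using (Σ; Σ-syntax; _×_; proj₁; proj₂; _,_)
open import Function.Bundles using (_⇔_)

record IdempotentSemiring (c : Level) : Set (suc c) where
  infixl 6 _+_
  infixl 7 _·_
  infix 4 _≤_
  field
    Carrier : Set c
    _+_ _·_ : Carrier → Carrier → Carrier
    0# 1#   : Carrier
    +-assoc : ∀ a b d → (a + b) + d ≡ a + (b + d)
    +-comm  : ∀ a b → a + b ≡ b + a
    +-idˡ   : ∀ a → 0# + a ≡ a
    +-idem  : ∀ a → a + a ≡ a
    ·-assoc : ∀ a b d → (a · b) · d ≡ a · (b · d)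
    ·-idˡ   : ∀ a → 1# · a ≡ a
    ·-idʳ   : ∀ a → a · 1# ≡ a
    distribˡ : ∀ a b d → a · (b + d) ≡ a · b + a · d
    distribʳ : ∀ a b d → (b + d) · a ≡ b · a + d · a
    zeroˡ   : ∀ a → 0# · a ≡ 0#
    zeroʳ   : ∀ a → a · 0# ≡ 0#

  _≤_ : Carrier → Carrier → Set c
  a ≤ b = a + b ≡ b

  IsComplement : Carrier → Carrier → Set c
  IsComplement p q = (p + q ≡ 1#) × (p · q ≡ 0#) × (q · p ≡ 0#)

  IsTest : Carrier → Set c
  IsTest p = (p ≤ 1#) × Σ[ q ∈ Carrier ] IsComplement p q

  -- tests (carrying a witness of their (unique) complement)
  Test : Set c
  Test = Σ[ p ∈ Carrier ] IsTest p

  ⌊_⌋ : Test → Carrier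
  ⌊ p ⌋ = proj₁ p

  ¬ₜ : Test → Carrier
  ¬ₜ p = proj₁ (proj₂ (proj₂ p))

  _≤ₜ_ : Test → Test → Set c
  p ≤ₜ q = ⌊ p ⌋ ≤ ⌊ q ⌋

  _≤ₘ_ : (Test → Test) → (Test → Test) → Set c
  f ≤ₘ g = ∀ p → f p ≤ₜ g p

  𝟏 : Test → Test
  𝟏 p = p

record ModalKleeneAlgebra (c : Level) : Set (suc c) where
  field
    semiring : IdempotentSemiring c
  open IdempotentSemiring semiring public
  infix 8 _*
  field
    _* : Carrier → Carrier
    *-unfoldˡ : ∀ a → 1# + a · (a *) ≤ a *
    *-inductˡ : ∀ a b d → b + a · d ≤ d → (a *) · b ≤ d
    *-unfoldʳ : ∀ a → 1# + (a *) · a ≤ a *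
    *-inductʳ : ∀ a b d → b + d · a ≤ d → b · (a *) ≤ d
    ∣_⟩ : Carrier → Test → Test
    ⟨_∣ : Carrier → Test → Test
    fdia-adj : ∀ a p q → (∣ a ⟩ p ≤ₜ q) ⇔ (¬ₜ q · a · ⌊ p ⌋ ≤ 0#)
    bdia-adj : ∀ a p q → (⟨ a ∣ p ≤ₜ q) ⇔ (⌊ p ⌋ · a · ¬ₜ q ≤ 0#)
    fdia-comp : ∀ a b p → ⌊ ∣ a · b ⟩ p ⌋ ≡ ⌊ ∣ a ⟩ (∣ b ⟩ p) ⌋
    bdia-comp : ∀ a b p → ⌊ ⟨ a · b ∣ p ⌋ ≡ ⌊ ⟨ b ∣ (⟨ a ∣ p) ⌋

  1ₜ : Test
  1ₜ = 1# , (+-idem 1# , (0# , (+-comm 1# 0# ≡-trans′ +-idˡ 1#) , zeroʳ 1# , zeroˡ 1#))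
    where
      open import Relation.Binary.PropositionalEquality using (trans)
      _≡-trans′_ : ∀ {x y z : Carrier} → x ≡ y → y ≡ z → x ≡ z
      _≡-trans′_ = trans

  dom : Carrier → Test
  dom a = ∣ a ⟩ 1ₜ

  nrm : Carrier → Carrier
  nrm a = (a *) · ¬ₜ (dom a)

  DConfluent : Carrier → Set c
  DConfluent a = (λ p → ⟨ a * ∣ (∣ a * ⟩ p)) ≤ₘ (λ p → ∣ a * ⟩ (⟨ a * ∣ p))

  DDeterministic : Carrier → Set c
  DDeterministic a = (λ p → ⟨ a ∣ (∣ a ⟩ p)) ≤ₘ 𝟏

module Submission where

-- Write e = ¬dom a (a test with e a = 0), t = |e⟩p and w = |a*⟩t.  Then
-- |nrm a⟩p = w, and the chain
--   ⟨nrm a|w = ⟨e|(⟨a*|w) ≤ e ⟨a*|w ≤ e |a*⟩(⟨a*|t)   (d-confluence)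
--            ≤ e |a*⟩t                               (⟨a*|t ≤ t, since t a = 0)
--            ≤ |e a*⟩t ≤ |e⟩t ≤ t ≤ p                 (e a* ≤ e)
-- proves ⟨nrm a|(|nrm a⟩p) ≤ p.

open import Defs
open import Level using (Level)
open import Relation.Binary.PropositionalEquality
  using (_≡_; refl; sym; trans; cong; subst; isEquivalence; module ≡-Reasoning)
open import Relation.Binary.Bundles using (Poset)
import Relation.Binary.Reasoning.PartialOrder as PartialOrderReasoning
open import Data.Product using (_,_; proj₁; proj₂)
open import Function.Bundles using (Equivalence)

module SemiringFacts {c : Level} (R : IdempotentSemiring c) where
  open IdempotentSemiring R

  +-idʳ : ∀ x → x + 0# ≡ x
  +-idʳ x = trans (+-comm x 0#) (+-idˡ x)

  ≤-reflexive : ∀ {x y} → x ≡ y → x ≤ y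
  ≤-reflexive {x} refl = +-idem x

  ≤-trans : ∀ {x y z} → x ≤ y → y ≤ z → x ≤ z
  ≤-trans {x} {y} {z} x≤y y≤z = begin
    x + z        ≡⟨ cong (x +_) (sym y≤z) ⟩
    x + (y + z)  ≡⟨ sym (+-assoc x y z) ⟩
    (x + y) + z  ≡⟨ cong (_+ z) x≤y ⟩
    y + z        ≡⟨ y≤z ⟩
    z            ∎
    where open ≡-Reasoning

  ≤-antisym : ∀ {x y} → x ≤ y → y ≤ x → x ≡ y
  ≤-antisym {x} {y} x≤y y≤x = trans (sym y≤x) (trans (+-comm y x) x≤y)

  ≤-poset : Poset c c c
  ≤-poset = record
    { Carrier = Carrier
    ; _≈_ = _≡_
    ; _≤_ = _≤_
    ; isPartialOrder = record
      { isPreorder = record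
        { isEquivalence = isEquivalence
        ; reflexive = ≤-reflexive
        ; trans = ≤-trans
        }
      ; antisym = ≤-antisym
      }
    }

  module ≤-Reasoning = PartialOrderReasoning ≤-poset
  open ≤-Reasoning

  ≤-refl : ∀ {x} → x ≤ x
  ≤-refl = ≤-reflexive refl

  0≤ : ∀ x → 0# ≤ x
  0≤ x = +-idˡ x

  ≤0⇒≡0 : ∀ {x} → x ≤ 0# → x ≡ 0#
  ≤0⇒≡0 {x} x≤0 = trans (sym (+-idʳ x)) x≤0

  +-upperʳ : ∀ x y → y ≤ x + y
  +-upperʳ x y = begin-equality
    y + (x + y)  ≡⟨ cong (y +_) (+-comm x y) ⟩
    y + (y + x)  ≡⟨ +-assoc y y x ⟨
    (y + y) + x  ≡⟨ cong (_+ x) (+-idem y) ⟩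
    y + x        ≡⟨ +-comm y x ⟩
    x + y        ∎

  +-lub : ∀ {x y z} → x ≤ z → y ≤ z → x + y ≤ z
  +-lub {x} {y} {z} x≤z y≤z = begin-equality
    (x + y) + z  ≡⟨ +-assoc x y z ⟩
    x + (y + z)  ≡⟨ cong (x +_) y≤z ⟩
    x + z        ≡⟨ x≤z ⟩
    z            ∎

  ·-monoʳ : ∀ {x y} z → x ≤ y → z · x ≤ z · y
  ·-monoʳ {x} {y} z x≤y = trans (sym (distribˡ z x y)) (cong (z ·_) x≤y)

  ·-monoˡ : ∀ {x y} z → x ≤ y → x · z ≤ y · z
  ·-monoˡ {x} {y} z x≤y = trans (sym (distribʳ z x y)) (cong (_· z) x≤y)

  subid-shrinksˡ : ∀ {e} y → e ≤ 1# → e · y ≤ y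
  subid-shrinksˡ {e} y e≤1 = begin
    e · y   ≤⟨ ·-monoˡ y e≤1 ⟩
    1# · y  ≡⟨ ·-idˡ y ⟩
    y       ∎

  subid-shrinksʳ : ∀ {e} y → e ≤ 1# → y · e ≤ y
  subid-shrinksʳ {e} y e≤1 = begin
    y · e   ≤⟨ ·-monoʳ y e≤1 ⟩
    y · 1#  ≡⟨ ·-idʳ y ⟩
    y       ∎

  test-≤1 : (p : Test) → ⌊ p ⌋ ≤ 1#
  test-≤1 p = proj₁ (proj₂ p)

  complement-sum : (p : Test) → ⌊ p ⌋ + ¬ₜ p ≡ 1#
  complement-sum p = proj₁ (proj₂ (proj₂ (proj₂ p)))

  complement-annihilatesʳ : (p : Test) → ⌊ p ⌋ · ¬ₜ p ≡ 0#
  complement-annihilatesʳ p = proj₁ (proj₂ (proj₂ (proj₂ (proj₂ p))))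

  complement-annihilatesˡ : (p : Test) → ¬ₜ p · ⌊ p ⌋ ≡ 0#
  complement-annihilatesˡ p = proj₂ (proj₂ (proj₂ (proj₂ (proj₂ p))))

  complementTest : Test → Test
  complementTest p =
      ¬ₜ p
    , subst (¬ₜ p ≤_) (complement-sum p) (+-upperʳ ⌊ p ⌋ (¬ₜ p))
    , ⌊ p ⌋
    , trans (+-comm (¬ₜ p) ⌊ p ⌋) (complement-sum p)
    , complement-annihilatesˡ p
    , complement-annihilatesʳ p

  test-fixes : (q : Test) (x : Carrier) → ¬ₜ q · x ≤ 0# → ⌊ q ⌋ · x ≡ x
  test-fixes q x ¬qx≤0 = begin-equality
    ⌊ q ⌋ · x                ≡⟨ +-idʳ (⌊ q ⌋ · x) ⟨
    ⌊ q ⌋ · x + 0#           ≡⟨ cong (⌊ q ⌋ · x +_) (≤0⇒≡0 ¬qx≤0) ⟨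
    ⌊ q ⌋ · x + ¬ₜ q · x     ≡⟨ distribʳ x ⌊ q ⌋ (¬ₜ q) ⟨
    (⌊ q ⌋ + ¬ₜ q) · x       ≡⟨ cong (_· x) (complement-sum q) ⟩
    1# · x                   ≡⟨ ·-idˡ x ⟩
    x                        ∎

  test-idem : (p : Test) → ⌊ p ⌋ · ⌊ p ⌋ ≡ ⌊ p ⌋
  test-idem p = test-fixes p ⌊ p ⌋ (≤-reflexive (complement-annihilatesˡ p))

  test-meet : ∀ (f : Test) {x y} → ⌊ f ⌋ ≤ x → ⌊ f ⌋ ≤ y → ⌊ f ⌋ ≤ x · y
  test-meet f {x} {y} f≤x f≤y = begin
    ⌊ f ⌋            ≡⟨ test-idem f ⟨
    ⌊ f ⌋ · ⌊ f ⌋    ≤⟨ ·-monoˡ ⌊ f ⌋ f≤x ⟩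
    x · ⌊ f ⌋        ≤⟨ ·-monoʳ x f≤y ⟩
    x · y            ∎

module ModalFacts {c : Level} (S : ModalKleeneAlgebra c) where
  open ModalKleeneAlgebra S
  open SemiringFacts semiring
  open ≤-Reasoning

  fdia-least : ∀ a p q → ¬ₜ q · a · ⌊ p ⌋ ≤ 0# → ∣ a ⟩ p ≤ₜ q
  fdia-least a p q = Equivalence.from (fdia-adj a p q)

  fdia-counit : ∀ a p → ¬ₜ (∣ a ⟩ p) · a · ⌊ p ⌋ ≤ 0#
  fdia-counit a p = Equivalence.to (fdia-adj a p (∣ a ⟩ p)) ≤-refl

  bdia-least : ∀ a p q → ⌊ p ⌋ · a · ¬ₜ q ≤ 0# → ⟨ a ∣ p ≤ₜ q
  bdia-least a p q = Equivalence.from (bdia-adj a p q)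

  bdia-counit : ∀ a p → ⌊ p ⌋ · a · ¬ₜ (⟨ a ∣ p) ≤ 0#
  bdia-counit a p = Equivalence.to (bdia-adj a p (⟨ a ∣ p)) ≤-refl

  fdia-mono : ∀ a {p p'} → p ≤ₜ p' → ∣ a ⟩ p ≤ₜ ∣ a ⟩ p'
  fdia-mono a {p} {p'} p≤p' = fdia-least a p (∣ a ⟩ p') (begin
    ¬ₜ (∣ a ⟩ p') · a · ⌊ p ⌋    ≤⟨ ·-monoʳ (¬ₜ (∣ a ⟩ p') · a) p≤p' ⟩
    ¬ₜ (∣ a ⟩ p') · a · ⌊ p' ⌋   ≤⟨ fdia-counit a p' ⟩
    0#                           ∎)

  fdia-monoˡ : ∀ {a b} p → a ≤ b → ∣ a ⟩ p ≤ₜ ∣ b ⟩ p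
  fdia-monoˡ {a} {b} p a≤b = fdia-least a p (∣ b ⟩ p) (begin
    ¬ₜ (∣ b ⟩ p) · a · ⌊ p ⌋   ≤⟨ ·-monoˡ ⌊ p ⌋ (·-monoʳ (¬ₜ (∣ b ⟩ p)) a≤b) ⟩
    ¬ₜ (∣ b ⟩ p) · b · ⌊ p ⌋   ≤⟨ fdia-counit b p ⟩
    0#                         ∎)

  bdia-mono : ∀ a {p p'} → p ≤ₜ p' → ⟨ a ∣ p ≤ₜ ⟨ a ∣ p'
  bdia-mono a {p} {p'} p≤p' = bdia-least a p (⟨ a ∣ p') (begin
    ⌊ p ⌋ · a · ¬ₜ (⟨ a ∣ p')    ≤⟨ ·-monoˡ (¬ₜ (⟨ a ∣ p')) (·-monoˡ a p≤p') ⟩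
    ⌊ p' ⌋ · a · ¬ₜ (⟨ a ∣ p')   ≤⟨ bdia-counit a p' ⟩
    0#                           ∎)

  fdia-subid-below : ∀ {e} p → e ≤ 1# → ∣ e ⟩ p ≤ₜ p
  fdia-subid-below {e} p e≤1 = fdia-least e p p (begin
    ¬ₜ p · e · ⌊ p ⌋     ≡⟨ ·-assoc (¬ₜ p) e ⌊ p ⌋ ⟩
    ¬ₜ p · (e · ⌊ p ⌋)   ≤⟨ ·-monoʳ (¬ₜ p) (subid-shrinksˡ ⌊ p ⌋ e≤1) ⟩
    ¬ₜ p · ⌊ p ⌋         ≡⟨ complement-annihilatesˡ p ⟩
    0#                   ∎)

  fdia-test-below : ∀ e p → ∣ ⌊ e ⌋ ⟩ p ≤ₜ e
  fdia-test-below e p = fdia-least ⌊ e ⌋ p e (begin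
    ¬ₜ e · ⌊ e ⌋ · ⌊ p ⌋   ≡⟨ cong (_· ⌊ p ⌋) (complement-annihilatesˡ e) ⟩
    0# · ⌊ p ⌋             ≡⟨ zeroˡ ⌊ p ⌋ ⟩
    0#                     ∎)

  bdia-subid-below : ∀ {e} p → e ≤ 1# → ⟨ e ∣ p ≤ₜ p
  bdia-subid-below {e} p e≤1 = bdia-least e p p (begin
    ⌊ p ⌋ · e · ¬ₜ p   ≤⟨ ·-monoˡ (¬ₜ p) (subid-shrinksʳ ⌊ p ⌋ e≤1) ⟩
    ⌊ p ⌋ · ¬ₜ p       ≡⟨ complement-annihilatesʳ p ⟩
    0#                 ∎)

  bdia-test-below : ∀ e p → ⟨ ⌊ e ⌋ ∣ p ≤ₜ e
  bdia-test-below e p = bdia-least ⌊ e ⌋ p e (begin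
    ⌊ p ⌋ · ⌊ e ⌋ · ¬ₜ e     ≡⟨ ·-assoc ⌊ p ⌋ ⌊ e ⌋ (¬ₜ e) ⟩
    ⌊ p ⌋ · (⌊ e ⌋ · ¬ₜ e)   ≡⟨ cong (⌊ p ⌋ ·_) (complement-annihilatesʳ e) ⟩
    ⌊ p ⌋ · 0#               ≡⟨ zeroʳ ⌊ p ⌋ ⟩
    0#                       ∎)

  bdia-test-≤ : ∀ e p → ⌊ ⟨ ⌊ e ⌋ ∣ p ⌋ ≤ ⌊ e ⌋ · ⌊ p ⌋
  bdia-test-≤ e p =
    test-meet (⟨ ⌊ e ⌋ ∣ p) (bdia-test-below e p) (bdia-subid-below p (test-≤1 e))

  fdia-subid-≥ : ∀ {e} p → e ≤ 1# → e · ⌊ p ⌋ ≤ ⌊ ∣ e ⟩ p ⌋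
  fdia-subid-≥ {e} p e≤1 = begin
    e · ⌊ p ⌋                  ≡⟨ test-fixes f (e · ⌊ p ⌋) ¬f-annihilates ⟨
    ⌊ f ⌋ · (e · ⌊ p ⌋)        ≤⟨ subid-shrinksʳ ⌊ f ⌋ ep≤1 ⟩
    ⌊ f ⌋                      ∎
    where
      f : Test
      f = ∣ e ⟩ p
      ¬f-annihilates : ¬ₜ f · (e · ⌊ p ⌋) ≤ 0#
      ¬f-annihilates = subst (_≤ 0#) (·-assoc (¬ₜ f) e ⌊ p ⌋) (fdia-counit e p)
      ep≤1 : e · ⌊ p ⌋ ≤ 1#
      ep≤1 = ≤-trans (subid-shrinksˡ ⌊ p ⌋ e≤1) (test-≤1 p)

  ¬dom-annihilates : ∀ a → ¬ₜ (dom a) · a ≤ 0#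
  ¬dom-annihilates a = begin
    ¬ₜ (dom a) · a        ≡⟨ ·-idʳ (¬ₜ (dom a) · a) ⟨
    ¬ₜ (dom a) · a · 1#   ≤⟨ fdia-counit a 1ₜ ⟩
    0#                    ∎

  star-invariantʳ : ∀ a x → x · a ≤ x → x · (a *) ≤ x
  star-invariantʳ a x xa≤x = *-inductʳ a x x (+-lub ≤-refl xa≤x)

  bdia-star-closed : ∀ a t → ⌊ t ⌋ · a ≤ ⌊ t ⌋ → ⟨ a * ∣ t ≤ₜ t
  bdia-star-closed a t ta≤t = bdia-least (a *) t t (begin
    ⌊ t ⌋ · (a *) · ¬ₜ t   ≤⟨ ·-monoˡ (¬ₜ t) (star-invariantʳ a ⌊ t ⌋ ta≤t) ⟩
    ⌊ t ⌋ · ¬ₜ t           ≡⟨ complement-annihilatesʳ t ⟩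
    0#                     ∎)

lemma12p2 : ∀ {c : Level} (S : ModalKleeneAlgebra c) (a : ModalKleeneAlgebra.Carrier S) → ModalKleeneAlgebra.DConfluent S a → ModalKleeneAlgebra.DDeterministic S (ModalKleeneAlgebra.nrm S a)
lemma12p2 S a confluent p = begin
  ⌊ ⟨ nrm a ∣ (∣ nrm a ⟩ p) ⌋        ≡⟨ bdia-comp (a *) e (∣ nrm a ⟩ p) ⟩
  ⌊ ⟨ e ∣ (⟨ a * ∣ (∣ nrm a ⟩ p)) ⌋  ≤⟨ bdia-test-≤ E (⟨ a * ∣ (∣ nrm a ⟩ p)) ⟩
  e · ⌊ ⟨ a * ∣ (∣ nrm a ⟩ p) ⌋      ≤⟨ ·-monoʳ e (bdia-mono (a *) (≤-reflexive (fdia-comp (a *) e p))) ⟩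
  e · ⌊ ⟨ a * ∣ w ⌋                  ≤⟨ ·-monoʳ e (confluent t) ⟩
  e · ⌊ ∣ a * ⟩ (⟨ a * ∣ t) ⌋        ≤⟨ ·-monoʳ e (fdia-mono (a *) (bdia-star-closed a t t-stable)) ⟩
  e · ⌊ w ⌋                          ≤⟨ fdia-subid-≥ w (test-≤1 E) ⟩
  ⌊ ∣ e ⟩ w ⌋                        ≡⟨ fdia-comp e (a *) t ⟨
  ⌊ ∣ e · (a *) ⟩ t ⌋                ≤⟨ fdia-monoˡ t (star-invariantʳ a e (≤-trans (¬dom-annihilates a) (0≤ e))) ⟩
  ⌊ ∣ e ⟩ t ⌋                        ≤⟨ fdia-subid-below t (test-≤1 E) ⟩
  ⌊ t ⌋                              ≤⟨ fdia-subid-below p (test-≤1 E) ⟩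
  ⌊ p ⌋                              ∎
  where
    open ModalKleeneAlgebra S
    open SemiringFacts semiring
    open ModalFacts S
    open ≤-Reasoning
    E : Test
    E = complementTest (dom a)
    e : Carrier
    e = ⌊ E ⌋
    t w : Test
    t = ∣ e ⟩ p
    w = ∣ a * ⟩ t
    t-stable : ⌊ t ⌋ · a ≤ ⌊ t ⌋
    t-stable = begin
      ⌊ t ⌋ · a  ≤⟨ ·-monoˡ a (fdia-test-below E p) ⟩
      e · a      ≤⟨ ¬dom-annihilates a ⟩
      0#         ≤⟨ 0≤ ⌊ t ⌋ ⟩
      ⌊ t ⌋      ∎
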